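{- Let $\mathcal{L}=(\mathcal{S},\mathcal{A},(\xrightarrow{a})_{a\in\mathcal{A}})$ be an (image-finite) LTS and let $r,s\in\mathcal{S}$ with $r\sim s$. Then for every $m\in\mathbb{N}$ and every $T\subseteq\mathcal{S}$, $\mathrm{EqLevels}(\mathrm{Region}(r,m),T)=\mathrm{EqLevels}(\mathrm{Region}(s,m),T)$.
   Context: $\sim$ is bisimilarity. Say $\mathcal{B}\subseteq\mathcal{S}\times\mathcal{S}$ covers $(s,t)$ if every $s\xrightarrow{a}s'$ has some $t\xrightarrow{a}t'$ with $(s',t')\in\mathcal{B}$ and vice versa; $\sim_0=\mathcal{S}\times\mathcal{S}$ and $\sim_{k+1}$ is the set of pairs covered by $\sim_k$. $\mathrm{EqL}(s,t)=k$ if $s\sim_k t$ and $s\not\sim_{k+1}t$, and $\mathrm{EqL}(s,t)=\omega$ if $s\sim t$ (the LTS is assumed image-finite, i.e. each $\{s'\mid s\xrightarrow{a}s'\}$ is finite, so these cases are exhaustive). $\mathrm{Region}(s,m)$ is the set of states $s'$ with $s\xrightarrow{w}s'$ for some word $w\in\mathcal{A}^*$ of length $|w|\le m$. For $R,T\subseteq\mathcal{S}$, $\mathrm{EqLevels}(R,T)=\{\mathrm{EqL}(r,t)\mid r\in R,\ t\in T\}\subseteq\mathbb{N}\cup\{\omega\}$. -}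

module Defs where

open import Data.Nat using (ℕ; zero; suc; _≤_)
open import Data.List using (List; []; _∷_; length)
open import Data.List.Membership.Propositional using (_∈_)
open import Data.Product using (Σ; ∃; _×_; _,_)
open import Relation.Nullary using (¬_)
open import Function.Bundles using (_⇔_)
open import Level using (Lift)
import Level
open import Data.Unit using (⊤)

record LTS : Set₁ where
  field
    S : Set
    A : Set
    step : A → S → S → Set
    imageFinite : (a : A) (s : S) →
      Σ (List S) λ succs → (s' : S) → step a s s' ⇔ (s' ∈ succs)

module _ (L : LTS) where
  open LTS L

  Rel : Set₁
  Rel = S → S → Set

  Covers : Rel → S → S → Set
  Covers B s t =
    ((a : A) (s' : S) → step a s s' → Σ S λ t' → step a t t' × B s' t')
    × ((a : A) (t' : S) → step a t t' → Σ S λ s' → step a s s' × B s' t')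

  IsBisimulation : Rel → Set
  IsBisimulation B = ∀ s t → B s t → Covers B s t

  -- bisimilarity: largest bisimulation (union of all bisimulations)
  Bisimilar : S → S → Set₁
  Bisimilar s t = Σ Rel λ B → IsBisimulation B × B s t

  BisimK : ℕ → Rel
  BisimK zero    s t = ⊤
  BisimK (suc k) s t = Covers (BisimK k) s t

  data ℕω : Set where
    fin : ℕ → ℕω
    ω   : ℕω

  -- EqLIs s t l  means  EqL(s,t) = l
  EqLIs : S → S → ℕω → Set₁
  EqLIs s t (fin k) = Lift (Level.suc Level.zero) (BisimK k s t × ¬ BisimK (suc k) s t)
  EqLIs s t ω       = Bisimilar s t

  data Path : S → List A → S → Set where
    [] : ∀ {s} → Path s [] s
    _∷_ : ∀ {s s' s'' a w} → step a s s' → Path s' w s'' → Path s (a ∷ w) s''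

  Region : S → ℕ → S → Set
  Region s m s' = Σ (List A) λ w → length w ≤ m × Path s w s'

  EqLevels : (S → Set) → (S → Set) → ℕω → Set₁
  EqLevels R T l = Σ S λ r → Σ S λ t → R r × T t × EqLIs r t l

-- Bisimilar states are interchangeable on both counts: every path from r is matched, with the
-- same word, by a path from s ending in a state bisimilar to the end of the first, and
-- bisimilar states have the same equivalence level EqL(-, t) to every state t, because ~ is
-- contained in each ~_k and both ~ and ~_k are transitive. Hence each level contributed by
-- Region(r, m) is also contributed by Region(s, m); symmetry of ~ gives the converse.
module Submission where

open import Defs
open import Data.Nat using (ℕ; zero; suc)
open import Data.Product using (Σ; _×_; _,_; proj₁; proj₂)
open import Data.Unit using (tt)
open import Function using (flip)
open import Function.Bundles using (_⇔_; mk⇔)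
open import Level using (lift)

module _ {L : LTS} where
  open LTS L

  infix 4 _∼_
  _∼_ : S → S → Set₁
  _∼_ = Bisimilar L

  _⨾_ : Rel L → Rel L → Rel L
  (B ⨾ C) x z = Σ S λ y → B x y × C y z

  flip-isBisimulation : ∀ {B} → IsBisimulation L B → IsBisimulation L (flip B)
  flip-isBisimulation isB x y bxy =
      (λ a x' x→x' → let (y' , y→y' , b) = proj₂ (isB y x bxy) a x' x→x' in y' , y→y' , b)
    , (λ a y' y→y' → let (x' , x→x' , b) = proj₁ (isB y x bxy) a y' y→y' in x' , x→x' , b)

  ⨾-isBisimulation : ∀ {B C} → IsBisimulation L B → IsBisimulation L C →
    IsBisimulation L (B ⨾ C)
  ⨾-isBisimulation isB isC x z (y , bxy , cyz) =
      (λ a x' x→x' →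
        let (y' , y→y' , b) = proj₁ (isB x y bxy) a x' x→x'
            (z' , z→z' , c) = proj₁ (isC y z cyz) a y' y→y'
        in z' , z→z' , (y' , b , c))
    , (λ a z' z→z' →
        let (y' , y→y' , c) = proj₂ (isC y z cyz) a z' z→z'
            (x' , x→x' , b) = proj₂ (isB x y bxy) a y' y→y'
        in x' , x→x' , (y' , b , c))

  ∼-sym : ∀ {x y} → x ∼ y → y ∼ x
  ∼-sym (B , isB , bxy) = flip B , flip-isBisimulation isB , bxy

  ∼-trans : ∀ {x y z} → x ∼ y → y ∼ z → x ∼ z
  ∼-trans (B , isB , bxy) (C , isC , cyz) =
    (B ⨾ C) , ⨾-isBisimulation isB isC , (_ , bxy , cyz)

  BisimK-respˡ : ∀ k {x y z} → x ∼ y → BisimK L k x z → BisimK L k y z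
  BisimK-respˡ zero    _                   _       = tt
  BisimK-respˡ (suc k) {x} {y} (B , isB , bxy) (forth , back) =
      (λ a y' y→y' →
        let (x' , x→x' , b) = proj₂ (isB x y bxy) a y' y→y'
            (z' , z→z' , h) = forth a x' x→x'
        in z' , z→z' , BisimK-respˡ k (B , isB , b) h)
    , (λ a z' z→z' →
        let (x' , x→x' , h) = back a z' z→z'
            (y' , y→y' , b) = proj₁ (isB x y bxy) a x' x→x'
        in y' , y→y' , BisimK-respˡ k (B , isB , b) h)

  EqLIs-respˡ : ∀ {x y t} l → x ∼ y → EqLIs L x t l → EqLIs L y t l
  EqLIs-respˡ (fin k) x∼y (lift (x∼ₖt , x≁ₖ₊₁t)) =
    lift (BisimK-respˡ k x∼y x∼ₖt , λ y∼ₖ₊₁t → x≁ₖ₊₁t (BisimK-respˡ (suc k) (∼-sym x∼y) y∼ₖ₊₁t))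
  EqLIs-respˡ ω x∼y x∼t = ∼-trans (∼-sym x∼y) x∼t

  Path-transfer : ∀ {r r' s w} → r ∼ s → Path L r w r' → Σ S λ s' → Path L s w s' × r' ∼ s'
  Path-transfer r∼s [] = _ , [] , r∼s
  Path-transfer {r} {s = s} (B , isB , brs) (_∷_ {s' = r₁} {a = a} r→r₁ p) =
    let (s₁ , s→s₁ , b) = proj₁ (isB r s brs) a r₁ r→r₁
        (s' , p' , r'∼s') = Path-transfer (B , isB , b) p
    in s' , s→s₁ ∷ p' , r'∼s'

  EqLevels-Region-respˡ : ∀ {r s} m (T : S → Set) l → r ∼ s →
    EqLevels L (Region L r m) T l → EqLevels L (Region L s m) T l
  EqLevels-Region-respˡ m T l r∼s (r' , t , (w , |w|≤m , p) , t∈T , eq) =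
    let (s' , p' , r'∼s') = Path-transfer r∼s p
    in s' , t , (w , |w|≤m , p') , t∈T , EqLIs-respˡ l r'∼s' eq

proposition5 : (L : LTS) (r s : LTS.S L) → Bisimilar L r s →
    (m : ℕ) (T : LTS.S L → Set) (l : ℕω L) →
    EqLevels L (Region L r m) T l ⇔ EqLevels L (Region L s m) T l
proposition5 L r s r∼s m T l =
  mk⇔ (EqLevels-Region-respˡ m T l r∼s) (EqLevels-Region-respˡ m T l (∼-sym {L = L} r∼s))
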